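{- Let $q(x,y,z)=\frac13(x^2+y^2+2z^2)$ and $I_2(x,y)=x^2+y^2$. Then there is an injective map $\varphi:\mathbb{Q}^2\to\mathbb{Q}^3$ sending every edge of $G(\mathbb{Q}^2,I_2)$ to an edge of $G(\mathbb{Q}^3,q)$ (so $G(\mathbb{Q}^2,I_2)$ is a subgraph of $G(\mathbb{Q}^3,q)$), but $I_2\not\preceq q$.
   Context: For a positive definite rational quadratic form $q$ in $n$ variables, $G(\mathbb{Q}^n,q)$ is the graph with vertex set $\mathbb{Q}^n$ in which $x,y$ are adjacent iff $q(x-y)=1$. Forms $h,q$ in the same number $N$ of variables are rationally equivalent if $h(x)=q(Tx)$ for some $T\in GL(N,\mathbb{Q})$. For forms $q_1$ in $k$ variables and $q$ in $n\ge k$ variables, $q_1\preceq q$ means there is a positive definite rational quadratic form $r$ in $n-k$ variables such that $h(x,y)=q_1(x)+r(y)$ is rationally equivalent to $q$. -}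

module Defs where

open import Data.Nat using (ℕ; zero; suc)
open import Data.Fin using (Fin; zero; suc; splitAt)
open import Data.Sum using (inj₁; inj₂)
open import Data.Integer using (+_)
open import Data.Rational using (ℚ; 0ℚ; 1ℚ; _+_; _*_; _-_; _<_; _/_)
open import Data.Vec using (Vec; lookup; tabulate; zipWith; replicate)
open import Data.Product using (Σ; _×_)
open import Relation.Binary.PropositionalEquality using (_≡_; _≢_)

Σᶠ : (n : ℕ) → (Fin n → ℚ) → ℚ
Σᶠ zero    f = 0ℚ
Σᶠ (suc n) f = f zero + Σᶠ n (λ i → f (suc i))

Mat : ℕ → Set
Mat n = Fin n → Fin n → ℚ

record QForm (n : ℕ) : Set where
  constructor form
  field
    coeff : Mat n
open QForm public

eval : {n : ℕ} → QForm n → Vec ℚ n → ℚ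
eval {n} q x = Σᶠ n (λ i → Σᶠ n (λ j → coeff q i j * lookup x i * lookup x j))

PosDef : {n : ℕ} → QForm n → Set
PosDef {n} q = (x : Vec ℚ n) → x ≢ replicate n 0ℚ → 0ℚ < eval q x

_·_ : {n : ℕ} → Mat n → Vec ℚ n → Vec ℚ n
_·_ {n} T x = tabulate (λ i → Σᶠ n (λ j → T i j * lookup x j))

_⊗_ : {n : ℕ} → Mat n → Mat n → Mat n
_⊗_ {n} S T i k = Σᶠ n (λ j → S i j * T j k)

δ : {n : ℕ} → Fin n → Fin n → ℚ
δ zero    zero    = 1ℚ
δ zero    (suc j) = 0ℚ
δ (suc i) zero    = 0ℚ
δ (suc i) (suc j) = δ i j

IdMat : {n : ℕ} → Mat n
IdMat = δ

InGL : {n : ℕ} → Mat n → Set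
InGL {n} T = Σ (Mat n) λ S → ((i j : Fin n) → (T ⊗ S) i j ≡ IdMat i j)
                            × ((i j : Fin n) → (S ⊗ T) i j ≡ IdMat i j)

RatEquiv : {N : ℕ} → QForm N → QForm N → Set
RatEquiv {N} h q = Σ (Mat N) λ T → InGL T × ((x : Vec ℚ N) → eval h x ≡ eval q (T · x))

_⊕_ : {k m : ℕ} → QForm k → QForm m → QForm (k Data.Nat.+ m)
_⊕_ {k} {m} q₁ r = form (λ i j → blk (splitAt k i) (splitAt k j))
  where
  blk : _ → _ → ℚ
  blk (inj₁ a) (inj₁ b) = coeff q₁ a b
  blk (inj₂ a) (inj₂ b) = coeff r a b
  blk (inj₁ a) (inj₂ b) = 0ℚ
  blk (inj₂ a) (inj₁ b) = 0ℚ

_⪯_ : {k m : ℕ} → QForm k → QForm (k Data.Nat.+ m) → Set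
_⪯_ {k} {m} q₁ q = Σ (QForm m) λ r → PosDef r × RatEquiv (q₁ ⊕ r) q

Adj : {n : ℕ} → QForm n → Vec ℚ n → Vec ℚ n → Set
Adj {n} q x y = eval q (zipWith _-_ x y) ≡ 1ℚ

I₂ : QForm 2
I₂ = form δ

diag3 : Fin 3 → ℚ
diag3 zero = + 1 / 3
diag3 (suc zero) = + 1 / 3
diag3 (suc (suc zero)) = + 2 / 3

qForm : QForm 3
qForm = form (λ i j → δ i j * diag3 i)

{-# OPTIONS --safe #-}
-- The embedding is φ (a , b) = (a , b , χ a + χ b) for a function χ : ℚ → {0, 1} with
-- χ (y + r) ≡ χ y + (numerator of r mod 2) whenever r has odd denominator: every rational splits
-- uniquely as y = j/2ᴷ + p/o with 0 ≤ j < 2ᴷ and o odd, and χ y is the parity of p.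
-- A rational unit vector (s , t) has odd denominators and numerators of opposite parity, so along
-- an edge of G(ℚ², I₂) the height χ a + χ b changes by ±1 and q (s , t , ±1) = (1 + 2)/3 = 1.
--
-- If I₂ ⊕ r were equivalent to q, the images u, v of the first two basis vectors would satisfy
-- q u = q v = 1 and q (u + v) = 2, and then (u₂v₀ − v₂u₀)² + (u₂v₁ − v₂u₁)² = 3 (u₂² + v₂²).
-- By descent modulo 3 this forces u₂ = 0, and then u₀² + u₁² = 3, which descent rules out again.
module Submission where

open import Defs
open import Data.Vec using (Vec)
open import Data.Rational as ℚ using (ℚ)
open import Data.Parity using (Parity; 0ℙ; 1ℙ)
open import Data.Product using (Σ; _×_; _,_; proj₁)
open import Relation.Binary.PropositionalEquality
open import Relation.Nullary using (¬_)
open import Relation.Nullary.Decidable using (dec⇒maybe)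
open import Data.Rational.Properties using (+-*-commutativeRing; _≟_)
import Tactic.RingSolver as RS
import Tactic.RingSolver.Core.AlmostCommutativeRing as ACR

ℚ-ring : ACR.AlmostCommutativeRing _ _
ℚ-ring = ACR.fromCommutativeRing +-*-commutativeRing (λ x → dec⇒maybe (ℚ.0ℚ ≟ x))

module Parities where

  open import Data.Nat using (ℕ; zero; suc; _+_; _*_; parity)
  open import Data.Nat.Coprimality using (Coprime)
  open import Data.Nat.Divisibility using (_∣_; divides)
  open import Data.Nat.Properties using (+-suc; *-comm)
  open import Data.Integer as ℤ using (ℤ; +_; -[1+_]; ∣_∣; _⊖_)
  open import Data.Integer.Properties using ([1+m]⊖[1+n]≡m⊖n; ∣i*j∣≡∣i∣*∣j∣)
  import Data.Parity as ℙ
  open import Data.Parity.Properties as ℙ using (+-homo-+; *-homo-*; p≢p⁻¹)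
  open import Relation.Nullary using (contradiction)

  data Halving : ℕ → Set where
    even : ∀ h → Halving (2 * h)
    odd  : ∀ h → Halving (suc (2 * h))

  halve : ∀ n → Halving n
  halve zero = even 0
  halve (suc n) with halve n
  ... | even h = odd h
  ... | odd h  = subst Halving (cong suc (+-suc h (h + 0))) (even (suc h))

  parity-even : ∀ h → parity (2 * h) ≡ 0ℙ
  parity-even h = *-homo-* 2 h

  parity-odd : ∀ h → parity (suc (2 * h)) ≡ 1ℙ
  parity-odd h = trans (+-homo-+ 1 (2 * h)) (cong (1ℙ ℙ.+_) (parity-even h))

  parity≡0⇒half : ∀ n → parity n ≡ 0ℙ → Σ ℕ λ h → n ≡ 2 * h
  parity≡0⇒half n pn with halve n
  ... | even h = h , refl
  ... | odd h  = contradiction (trans (sym pn) (parity-odd h)) (p≢p⁻¹ 0ℙ)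

  parity≡1⇒half : ∀ n → parity n ≡ 1ℙ → Σ ℕ λ h → n ≡ suc (2 * h)
  parity≡1⇒half n pn with halve n
  ... | odd h  = h , refl
  ... | even h = contradiction (trans (sym (parity-even h)) pn) (p≢p⁻¹ 0ℙ)

  coprime-to-even⇒odd : ∀ {m n} → Coprime m n → parity n ≡ 0ℙ → parity m ≡ 1ℙ
  coprime-to-even⇒odd {m} {n} c pn with parity m in pm
  ... | 1ℙ = refl
  ... | 0ℙ with parity≡0⇒half m pm | parity≡0⇒half n pn
  ...        | a , refl | b , refl with c (divides a (*-comm 2 a) , divides b (*-comm 2 b))
  ...          | ()

  2∣⇒parity≡0 : ∀ {n} → 2 ∣ n → parity n ≡ 0ℙ
  2∣⇒parity≡0 (divides q refl) = trans (*-homo-* q 2) (ℙ.*-zeroʳ (parity q))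

  parity-odd*odd : ∀ m n → parity m ≡ 1ℙ → parity n ≡ 1ℙ → parity (m * n) ≡ 1ℙ
  parity-odd*odd m n odd-m odd-n = trans (*-homo-* m n) (cong₂ ℙ._*_ odd-m odd-n)

  parity-suc+suc : ∀ m n → parity (suc m) ℙ.+ parity (suc n) ≡ parity m ℙ.+ parity n
  parity-suc+suc m n = begin
    parity (suc m) ℙ.+ parity (suc n)  ≡⟨ +-homo-+ (suc m) (suc n) ⟨
    parity (suc m + suc n)             ≡⟨ cong (λ k → parity (suc k)) (+-suc m n) ⟩
    parity (m + n)                     ≡⟨ +-homo-+ m n ⟩
    parity m ℙ.+ parity n              ∎
    where open ≡-Reasoning

  parityℤ : ℤ → Parity
  parityℤ i = parity ∣ i ∣

  parity-∣⊖∣ : ∀ m n → parity ∣ m ⊖ n ∣ ≡ parity m ℙ.+ parity n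
  parity-∣⊖∣ m       zero    = sym (ℙ.+-identityʳ (parity m))
  parity-∣⊖∣ zero    (suc n) = refl
  parity-∣⊖∣ (suc m) (suc n) = trans (cong (λ i → parity ∣ i ∣) ([1+m]⊖[1+n]≡m⊖n m n))
                                     (trans (parity-∣⊖∣ m n) (sym (parity-suc+suc m n)))

  parityℤ-+ : ∀ i j → parityℤ (i ℤ.+ j) ≡ parityℤ i ℙ.+ parityℤ j
  parityℤ-+ (+ m)    (+ n)    = +-homo-+ m n
  parityℤ-+ (+ m)    -[1+ n ] = parity-∣⊖∣ m (suc n)
  parityℤ-+ -[1+ m ] (+ n)    = trans (parity-∣⊖∣ n (suc m)) (ℙ.+-comm (parity n) _)
  parityℤ-+ -[1+ m ] -[1+ n ] = trans (+-homo-+ m n) (sym (parity-suc+suc m n))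

  parityℤ-* : ∀ i j → parityℤ (i ℤ.* j) ≡ parityℤ i ℙ.* parityℤ j
  parityℤ-* i j = trans (cong parity (∣i*j∣≡∣i∣*∣j∣ i j)) (*-homo-* ∣ i ∣ ∣ j ∣)

  parityℤ-*-odd : ∀ i {m} → parity m ≡ 1ℙ → parityℤ (i ℤ.* + m) ≡ parityℤ i
  parityℤ-*-odd i {m} odd-m =
    trans (parityℤ-* i (+ m)) (trans (cong (parityℤ i ℙ.*_) odd-m) (ℙ.*-identityʳ (parityℤ i)))

module ClearingDenominators where

  open import Data.Nat as ℕ using ()
  open import Data.Integer as ℤ using (ℤ; +_; -[1+_]; ∣_∣)
  open import Data.Integer.Properties using (pos-*)
  open import Data.Rational as ℚ using (toℚᵘ)
  open import Data.Rational.Properties using (toℚᵘ-homo-+; toℚᵘ-homo-*)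
  import Data.Rational.Unnormalised as ℚᵘ
  import Data.Rational.Unnormalised.Properties as ℚᵘ

  i*i≡+∣i∣*∣i∣ : ∀ i → i ℤ.* i ≡ + (∣ i ∣ ℕ.* ∣ i ∣)
  i*i≡+∣i∣*∣i∣ (+ n)    = sym (pos-* n n)
  i*i≡+∣i∣*∣i∣ -[1+ n ] = refl

  toℚᵘ-sumOfSquares : ∀ a b → toℚᵘ (a ℚ.* a ℚ.+ b ℚ.* b) ℚᵘ.≃ toℚᵘ a ℚᵘ.* toℚᵘ a ℚᵘ.+ toℚᵘ b ℚᵘ.* toℚᵘ b
  toℚᵘ-sumOfSquares a b =
    ℚᵘ.≃-trans (toℚᵘ-homo-+ (a ℚ.* a) (b ℚ.* b)) (ℚᵘ.+-cong (toℚᵘ-homo-* a a) (toℚᵘ-homo-* b b))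

module UnitCircle where

  open import Data.Nat using (suc; _+_; _*_; parity; NonZero)
  open import Data.Nat.Coprimality as Coprime using (Coprime; coprime-divisor; recompute)
  open import Data.Nat.Divisibility using (_∣_; ∣-trans; ∣-antisym; ∣m+n∣m⇒∣n; n∣m*n; m∣m*n)
  open import Data.Nat.Properties
    using (<-cmp; <⇒≢; *-mono-<; +-comm; *-comm; *-cancelʳ-≡; *-cancelˡ-≡; m*n≢0; even≢odd; *-distribʳ-+)
  open import Data.Nat.Tactic.RingSolver using (solve-∀)
  open import Data.Integer as ℤ using (+_; ∣_∣)
  open import Data.Integer.Properties as ℤ using (pos-*; +-injective)
  open import Data.Rational as ℚ using (mkℚ; 1ℚ; ↥_; ↧ₙ_)
  open import Data.Rational.Properties using (toℚᵘ-cong)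
  import Data.Rational.Unnormalised.Properties as ℚᵘ
  import Data.Parity as ℙ
  open import Data.Parity.Properties using (+-homo-+; *-homo-*; *-idem)
  open import Relation.Binary.Definitions using (tri<; tri≈; tri>)
  open import Relation.Nullary using (contradiction)
  open Parities
  open ClearingDenominators

  coprime-*self : ∀ {m n} → Coprime m n → Coprime m (n * n)
  coprime-*self c (d∣m , d∣nn) = c (d∣m , coprime-divisor (λ (e∣d , e∣n) → c (∣-trans e∣d d∣m , e∣n)) d∣nn)

  coprime-squares : ∀ {m n} → Coprime m n → Coprime (m * m) (n * n)
  coprime-squares c = coprime-*self (Coprime.sym (coprime-*self (Coprime.sym c)))

  parity-square : ∀ n → parity (n * n) ≡ parity n
  parity-square n = trans (*-homo-* n n) (*-idem (parity n))

  square-injective : ∀ {m n} → m * m ≡ n * n → m ≡ n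
  square-injective {m} {n} eq with <-cmp m n
  ... | tri< m<n _ _ = contradiction eq (<⇒≢ (*-mono-< m<n m<n))
  ... | tri≈ _ m≡n _ = m≡n
  ... | tri> _ _ n<m = contradiction (sym eq) (<⇒≢ (*-mono-< n<m n<m))

  square-divides : ∀ {A B D E} → Coprime A D → A * A * (E * E) + B * B * (D * D) ≡ D * D * (E * E) →
                   D * D ∣ E * E
  square-divides {A} {B} {D} {E} cAD eq = coprime-divisor (Coprime.sym (coprime-squares cAD)) D²∣A²E²
    where
    D²∣A²E² : D * D ∣ A * A * (E * E)
    D²∣A²E² = ∣m+n∣m⇒∣n (subst (D * D ∣_) (trans (sym eq) (+-comm (A * A * (E * E)) _)) (m∣m*n (E * E)))
                        (n∣m*n (B * B))

  odd²+odd²≢even² : ∀ a b d → suc (2 * a) * suc (2 * a) + suc (2 * b) * suc (2 * b) ≢ 2 * d * (2 * d)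
  odd²+odd²≢even² a b d eq = even≢odd (d * d) (a * a + a + b * b + b) (*-cancelˡ-≡ _ _ 2 (begin
    2 * (2 * (d * d))                                        ≡⟨ lhs d ⟩
    2 * d * (2 * d)                                          ≡⟨ eq ⟨
    suc (2 * a) * suc (2 * a) + suc (2 * b) * suc (2 * b)    ≡⟨ rhs a b ⟩
    2 * suc (2 * (a * a + a + b * b + b))                    ∎))
    where
    open ≡-Reasoning
    lhs : ∀ d → 2 * (2 * (d * d)) ≡ 2 * d * (2 * d)
    lhs = solve-∀
    rhs : ∀ a b → suc (2 * a) * suc (2 * a) + suc (2 * b) * suc (2 * b) ≡ 2 * suc (2 * (a * a + a + b * b + b))
    rhs = solve-∀

  primitive-pythagorean-parities : ∀ {A B D} → Coprime A D → Coprime B D → A * A + B * B ≡ D * D →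
                                   parity D ≡ 1ℙ × parity A ℙ.+ parity B ≡ 1ℙ
  primitive-pythagorean-parities {A} {B} {D} cAD cBD eq with parity D in pD
  ... | 1ℙ = refl , (begin
    parity A ℙ.+ parity B               ≡⟨ cong₂ ℙ._+_ (parity-square A) (parity-square B) ⟨
    parity (A * A) ℙ.+ parity (B * B)   ≡⟨ +-homo-+ (A * A) (B * B) ⟨
    parity (A * A + B * B)              ≡⟨ cong parity eq ⟩
    parity (D * D)                      ≡⟨ parity-square D ⟩
    parity D                            ≡⟨ pD ⟩
    1ℙ                                  ∎)
    where open ≡-Reasoning
  ... | 0ℙ with parity≡1⇒half A (coprime-to-even⇒odd cAD pD)
              | parity≡1⇒half B (coprime-to-even⇒odd cBD pD)
              | parity≡0⇒half D pD
  ...        | a , refl | b , refl | d , refl = contradiction eq (odd²+odd²≢even² a b d)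

  unitCircle-ℕ : ∀ {A B D E} .{{_ : NonZero D}} → Coprime A D → Coprime B E →
                 A * A * (E * E) + B * B * (D * D) ≡ D * D * (E * E) →
                 parity D ≡ 1ℙ × parity E ≡ 1ℙ × parity A ℙ.+ parity B ≡ 1ℙ
  unitCircle-ℕ {A} {B} {D} {E} cAD cBE eq with square-injective {D} {E} D²≡E²
    where
    D²≡E² : D * D ≡ E * E
    D²≡E² = ∣-antisym (square-divides {B = B} {E = E} cAD eq)
                      (square-divides {B = A} {E = D} cBE
                        (trans (+-comm (B * B * (D * D)) _) (trans eq (*-comm (D * D) (E * E)))))
  ... | refl with primitive-pythagorean-parities cAD cBE
                    (*-cancelʳ-≡ _ _ (D * D) {{m*n≢0 D D}} (trans (*-distribʳ-+ (D * D) (A * A) (B * B)) eq))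
  ...   | oddD , oddA+B = oddD , oddD , oddA+B

  unitCircle : ∀ s t → s ℚ.* s ℚ.+ t ℚ.* t ≡ 1ℚ →
               parity (↧ₙ s) ≡ 1ℙ × parity (↧ₙ t) ≡ 1ℙ × parityℤ (↥ s) ℙ.+ parityℤ (↥ t) ≡ 1ℙ
  unitCircle s@(mkℚ _ _ cs) t@(mkℚ _ _ ct) eq = unitCircle-ℕ (recompute cs) (recompute ct) (+-injective (begin
    + (∣ ↥ s ∣ * ∣ ↥ s ∣ * (↧ₙ t * ↧ₙ t) + ∣ ↥ t ∣ * ∣ ↥ t ∣ * (↧ₙ s * ↧ₙ s))
      ≡⟨ cong₂ ℤ._+_ (numerator-square s t) (numerator-square t s) ⟩
    ↥ s ℤ.* ↥ s ℤ.* + (↧ₙ t * ↧ₙ t) ℤ.+ ↥ t ℤ.* ↥ t ℤ.* + (↧ₙ s * ↧ₙ s)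
      ≡⟨ ℤ.*-identityʳ _ ⟨
    (↥ s ℤ.* ↥ s ℤ.* + (↧ₙ t * ↧ₙ t) ℤ.+ ↥ t ℤ.* ↥ t ℤ.* + (↧ₙ s * ↧ₙ s)) ℤ.* + 1
      ≡⟨ ℚᵘ.drop-*≡* (ℚᵘ.≃-trans (ℚᵘ.≃-sym (toℚᵘ-sumOfSquares s t)) (toℚᵘ-cong eq)) ⟩
    + 1 ℤ.* + (↧ₙ s * ↧ₙ s * (↧ₙ t * ↧ₙ t))
      ≡⟨ ℤ.*-identityˡ _ ⟩
    + (↧ₙ s * ↧ₙ s * (↧ₙ t * ↧ₙ t))
      ∎))
    where
    open ≡-Reasoning
    numerator-square : ∀ a b → + (∣ ↥ a ∣ * ∣ ↥ a ∣ * (↧ₙ b * ↧ₙ b)) ≡ ↥ a ℤ.* ↥ a ℤ.* + (↧ₙ b * ↧ₙ b)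
    numerator-square a b = trans (pos-* (∣ ↥ a ∣ * ∣ ↥ a ∣) (↧ₙ b * ↧ₙ b))
                                 (cong (ℤ._* + (↧ₙ b * ↧ₙ b)) (sym (i*i≡+∣i∣*∣i∣ (↥ a))))

module SumsOfTwoSquares where

  open import Data.Nat using (ℕ; zero; suc; _+_; _*_; _<_; _%_; s≤s; z≤n)
  open import Data.Nat.Properties using (*-comm; *-cancelˡ-≡; *-distribʳ-+; m+n≡0⇒m≡0; m+n≡0⇒n≡0; m<m*n)
  open import Data.Nat.DivMod using (%-distribˡ-+; %-distribˡ-*; m%n<n)
  open import Data.Nat.Divisibility using (_∣_; divides; m%n≡0⇒n∣m; n∣m⇒m%n≡0)
  open import Data.Nat.Induction using (<-rec)
  open import Induction.WellFounded using (WfRec)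
  open import Data.Nat.Tactic.RingSolver using (solve-∀)
  open import Data.Integer as ℤ using (ℤ; +_; ∣_∣; 0ℤ)
  open import Data.Integer.Properties using (pos-*; ∣i∣≡0⇒i≡0; +-injective; i*j≡0⇒i≡0∨j≡0)
  open import Data.Integer.Tactic.RingSolver renaming (solve-∀ to ℤ-solve-∀)
  open import Data.Rational as ℚ using (0ℚ; ↥_; ↧_; toℚᵘ)
  open import Data.Rational.Properties using (toℚᵘ-cong; toℚᵘ-homo-*; ↥p≡0⇒p≡0)
  import Data.Rational.Unnormalised as ℚᵘ
  import Data.Rational.Unnormalised.Properties as ℚᵘ
  open import Data.Product using (map)
  open import Data.Sum using ([_,_]′)
  open import Function using (id)
  open ClearingDenominators

  zero-residues : ∀ r s → r < 3 → s < 3 → (r * r + s * s) % 3 ≡ 0 → r ≡ 0 × s ≡ 0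
  zero-residues 0 0 _ _ _ = refl , refl
  zero-residues 0 1 _ _ ()
  zero-residues 0 2 _ _ ()
  zero-residues 1 0 _ _ ()
  zero-residues 1 1 _ _ ()
  zero-residues 1 2 _ _ ()
  zero-residues 2 0 _ _ ()
  zero-residues 2 1 _ _ ()
  zero-residues 2 2 _ _ ()
  zero-residues (suc (suc (suc _))) _ (s≤s (s≤s (s≤s ()))) _ _
  zero-residues _ (suc (suc (suc _))) _ (s≤s (s≤s (s≤s ()))) _

  3∣x²+y²⇒3∣x,y : ∀ x y → 3 ∣ (x * x + y * y) → (3 ∣ x) × (3 ∣ y)
  3∣x²+y²⇒3∣x,y x y 3∣x²+y² with zero-residues (x % 3) (y % 3) (m%n<n x 3) (m%n<n y 3) residues≡0
    where
    open ≡-Reasoning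
    residues≡0 : ((x % 3) * (x % 3) + (y % 3) * (y % 3)) % 3 ≡ 0
    residues≡0 = begin
      ((x % 3) * (x % 3) + (y % 3) * (y % 3)) % 3
        ≡⟨ %-distribˡ-+ ((x % 3) * (x % 3)) _ 3 ⟩
      (((x % 3) * (x % 3)) % 3 + ((y % 3) * (y % 3)) % 3) % 3
        ≡⟨ cong₂ (λ a b → (a + b) % 3) (%-distribˡ-* x x 3) (%-distribˡ-* y y 3) ⟨
      ((x * x) % 3 + (y * y) % 3) % 3
        ≡⟨ %-distribˡ-+ (x * x) (y * y) 3 ⟨
      (x * x + y * y) % 3
        ≡⟨ n∣m⇒m%n≡0 _ 3 3∣x²+y² ⟩
      0
        ∎
  ... | x%3≡0 , y%3≡0 = m%n≡0⇒n∣m x 3 x%3≡0 , m%n≡0⇒n∣m y 3 y%3≡0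

  tripled-squares : ∀ x y → x * 3 * (x * 3) + y * 3 * (y * 3) ≡ 3 * (3 * (x * x + y * y))
  tripled-squares = solve-∀

  descent-step : ∀ u v x y → x * x + y * y ≡ 3 * (u * u + v * v) →
                 Σ ℕ λ u′ → Σ ℕ λ v′ → Σ ℕ λ x′ → Σ ℕ λ y′ →
                 u ≡ u′ * 3 × v ≡ v′ * 3 × x′ * x′ + y′ * y′ ≡ 3 * (u′ * u′ + v′ * v′)
  descent-step u v x y eq
    with 3∣x²+y²⇒3∣x,y x y (divides (u * u + v * v) (trans eq (*-comm 3 (u * u + v * v))))
  ... | divides x′ refl , divides y′ refl
    with 3∣x²+y²⇒3∣x,y u v (divides (x′ * x′ + y′ * y′)
           (trans (*-cancelˡ-≡ _ _ 3 (trans (sym eq) (tripled-squares x′ y′))) (*-comm 3 (x′ * x′ + y′ * y′))))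
  ... | divides u′ refl , divides v′ refl = u′ , v′ , x′ , y′ , refl , refl ,
    *-cancelˡ-≡ _ _ 3 (*-cancelˡ-≡ _ _ 3
      (trans (sym (tripled-squares x′ y′)) (trans eq (cong (3 *_) (tripled-squares u′ v′)))))

  x²+y²≡3[u²+v²]⇒u,v≡0 : ∀ u v x y → x * x + y * y ≡ 3 * (u * u + v * v) → u ≡ 0 × v ≡ 0
  x²+y²≡3[u²+v²]⇒u,v≡0 u v x y = <-rec P step (u + v) u v x y refl
    where
    P : ℕ → Set
    P n = ∀ u v x y → u + v ≡ n → x * x + y * y ≡ 3 * (u * u + v * v) → u ≡ 0 × v ≡ 0
    step : ∀ n → WfRec _<_ P n → P n
    step _ rec u v x y refl eq with descent-step u v x y eq
    ... | u′ , v′ , x′ , y′ , refl , refl , eq′ = map (cong (_* 3)) (cong (_* 3)) (vanish (u′ + v′) refl)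
      where
      vanish : ∀ n → u′ + v′ ≡ n → u′ ≡ 0 × v′ ≡ 0
      vanish zero    u′+v′≡0 = m+n≡0⇒m≡0 u′ u′+v′≡0 , m+n≡0⇒n≡0 u′ u′+v′≡0
      vanish (suc k) u′+v′≡1+k = rec shrinks u′ v′ x′ y′ refl eq′
        where
        shrinks : u′ + v′ < u′ * 3 + v′ * 3
        shrinks = subst₂ _<_ (sym u′+v′≡1+k) (trans (cong (_* 3) (sym u′+v′≡1+k)) (*-distribʳ-+ 3 u′ v′))
                         (m<m*n (suc k) 3 (s≤s (s≤s z≤n)))

  x²+y²≡3[u²+v²]⇒u,v≡0ℤ : ∀ u v x y → x ℤ.* x ℤ.+ y ℤ.* y ≡ + 3 ℤ.* (u ℤ.* u ℤ.+ v ℤ.* v) → u ≡ 0ℤ × v ≡ 0ℤ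
  x²+y²≡3[u²+v²]⇒u,v≡0ℤ u v x y eq =
    map ∣i∣≡0⇒i≡0 ∣i∣≡0⇒i≡0 (x²+y²≡3[u²+v²]⇒u,v≡0 (∣ u ∣) (∣ v ∣) (∣ x ∣) (∣ y ∣) (+-injective (begin
      + (∣ x ∣ * ∣ x ∣ + ∣ y ∣ * ∣ y ∣)              ≡⟨ cong₂ ℤ._+_ (i*i≡+∣i∣*∣i∣ x) (i*i≡+∣i∣*∣i∣ y) ⟨
      x ℤ.* x ℤ.+ y ℤ.* y                            ≡⟨ eq ⟩
      + 3 ℤ.* (u ℤ.* u ℤ.+ v ℤ.* v)                  ≡⟨ cong (+ 3 ℤ.*_) (cong₂ ℤ._+_ (i*i≡+∣i∣*∣i∣ u) (i*i≡+∣i∣*∣i∣ v)) ⟩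
      + 3 ℤ.* + (∣ u ∣ * ∣ u ∣ + ∣ v ∣ * ∣ v ∣)      ≡⟨ pos-* 3 (∣ u ∣ * ∣ u ∣ + ∣ v ∣ * ∣ v ∣) ⟨
      + (3 * (∣ u ∣ * ∣ u ∣ + ∣ v ∣ * ∣ v ∣))        ∎)))
    where open ≡-Reasoning

  3ℚ : ℚ
  3ℚ = + 3 ℚ./ 1

  x²+y²≡3[u²+v²]⇒u,v≡0ℚ : ∀ u v x y → x ℚ.* x ℚ.+ y ℚ.* y ≡ 3ℚ ℚ.* (u ℚ.* u ℚ.+ v ℚ.* v) → u ≡ 0ℚ × v ≡ 0ℚ
  x²+y²≡3[u²+v²]⇒u,v≡0ℚ u@record{} v@record{} x@record{} y@record{} eq =
    map (numerator≡0 u v x y) (numerator≡0 v u x y) (x²+y²≡3[u²+v²]⇒u,v≡0ℤ U V X Y cleared)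
    where
    open ≡-Reasoning
    X = ↥ x ℤ.* (↧ y ℤ.* ↧ u ℤ.* ↧ v)
    Y = ↥ y ℤ.* (↧ x ℤ.* ↧ u ℤ.* ↧ v)
    U = ↥ u ℤ.* (↧ v ℤ.* ↧ x ℤ.* ↧ y)
    V = ↥ v ℤ.* (↧ u ℤ.* ↧ x ℤ.* ↧ y)
    eqᵘ : toℚᵘ x ℚᵘ.* toℚᵘ x ℚᵘ.+ toℚᵘ y ℚᵘ.* toℚᵘ y ℚᵘ.≃ toℚᵘ 3ℚ ℚᵘ.* (toℚᵘ u ℚᵘ.* toℚᵘ u ℚᵘ.+ toℚᵘ v ℚᵘ.* toℚᵘ v)
    eqᵘ = ℚᵘ.≃-trans (ℚᵘ.≃-sym (toℚᵘ-sumOfSquares x y)) (ℚᵘ.≃-trans (toℚᵘ-cong eq)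
            (ℚᵘ.≃-trans (toℚᵘ-homo-* 3ℚ (u ℚ.* u ℚ.+ v ℚ.* v)) (ℚᵘ.*-congˡ {toℚᵘ 3ℚ} (toℚᵘ-sumOfSquares u v))))
    cleared : X ℤ.* X ℤ.+ Y ℤ.* Y ≡ + 3 ℤ.* (U ℤ.* U ℤ.+ V ℤ.* V)
    cleared = begin
      X ℤ.* X ℤ.+ Y ℤ.* Y
        ≡⟨ expand-lhs (↥ x) (↥ y) (↧ x) (↧ y) (↧ u) (↧ v) ⟩
      (↥ x ℤ.* ↥ x ℤ.* (↧ y ℤ.* ↧ y) ℤ.+ ↥ y ℤ.* ↥ y ℤ.* (↧ x ℤ.* ↧ x)) ℤ.* (+ 1 ℤ.* (↧ u ℤ.* ↧ u ℤ.* (↧ v ℤ.* ↧ v)))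
        ≡⟨ ℚᵘ.drop-*≡* eqᵘ ⟩
      + 3 ℤ.* (↥ u ℤ.* ↥ u ℤ.* (↧ v ℤ.* ↧ v) ℤ.+ ↥ v ℤ.* ↥ v ℤ.* (↧ u ℤ.* ↧ u)) ℤ.* (↧ x ℤ.* ↧ x ℤ.* (↧ y ℤ.* ↧ y))
        ≡⟨ expand-rhs (↥ u) (↥ v) (↧ x) (↧ y) (↧ u) (↧ v) ⟨
      + 3 ℤ.* (U ℤ.* U ℤ.+ V ℤ.* V)
        ∎
      where
      expand-lhs : ∀ a b A B C D →
        (a ℤ.* (B ℤ.* C ℤ.* D)) ℤ.* (a ℤ.* (B ℤ.* C ℤ.* D)) ℤ.+ (b ℤ.* (A ℤ.* C ℤ.* D)) ℤ.* (b ℤ.* (A ℤ.* C ℤ.* D))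
          ≡ (a ℤ.* a ℤ.* (B ℤ.* B) ℤ.+ b ℤ.* b ℤ.* (A ℤ.* A)) ℤ.* (+ 1 ℤ.* (C ℤ.* C ℤ.* (D ℤ.* D)))
      expand-lhs = ℤ-solve-∀
      expand-rhs : ∀ c d A B C D →
        + 3 ℤ.* ((c ℤ.* (D ℤ.* A ℤ.* B)) ℤ.* (c ℤ.* (D ℤ.* A ℤ.* B))
                 ℤ.+ (d ℤ.* (C ℤ.* A ℤ.* B)) ℤ.* (d ℤ.* (C ℤ.* A ℤ.* B)))
          ≡ + 3 ℤ.* (c ℤ.* c ℤ.* (D ℤ.* D) ℤ.+ d ℤ.* d ℤ.* (C ℤ.* C)) ℤ.* (A ℤ.* A ℤ.* (B ℤ.* B))
      expand-rhs = ℤ-solve-∀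
    numerator≡0 : ∀ p a b c → ↥ p ℤ.* (↧ a ℤ.* ↧ b ℤ.* ↧ c) ≡ 0ℤ → p ≡ 0ℚ
    numerator≡0 p record{} record{} record{} eq = ↥p≡0⇒p≡0 p ([ id , (λ ()) ]′ (i*j≡0⇒i≡0∨j≡0 (↥ p) eq))

module DyadicSplittings where

  open import Data.Nat as ℕ using (ℕ; zero; suc; _+_; _*_; _^_; _<_; parity; NonZero; pred; s≤s; z≤n)
  open import Data.Nat.Properties as ℕ using (*-comm; *-assoc; *-identityˡ; suc-pred; m^n≢0; <⇒≱)
  open import Data.Nat.Divisibility using (_∣_; divides; ∣-trans; m∣m*n; 1∣_; *-cancelˡ-∣; *-monoʳ-∣; ∣⇒≤)
  open import Data.Nat.Induction using (<-rec)
  open import Induction.WellFounded using (WfRec)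
  open import Data.Nat.Tactic.RingSolver using (solve-∀)
  open import Data.Integer as ℤ using (ℤ; +_; ∣_∣; 0ℤ)
  open import Data.Integer.Properties as ℤ
    using (pos-*; ∣i*j∣≡∣i∣*∣j∣; ∣i∣≡0⇒i≡0; [+m]-[+n]≡m⊖n; ∣m⊝n∣≤m⊔n; i-j≡0⇒i≡j)
  open import Data.Integer.DivMod using (_%ℕ_; _/ℕ_; n%ℕd<d; a≡a%ℕn+[a/ℕn]*n)
  open import Data.Integer.Tactic.RingSolver renaming (solve-∀ to ℤ-solve-∀)
  open import Data.Rational as ℚ using (mkℚ; toℚᵘ; ↥_; ↧ₙ_)
  open import Data.Rational.Properties using (toℚᵘ-homo-+)
  open import Data.Rational.Unnormalised as ℚᵘ using (ℚᵘ; mkℚᵘ; _≃_; *≡*; _/_)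
  import Data.Rational.Unnormalised.Properties as ℚᵘ
  import Data.Parity as ℙ
  open import Data.Parity.Properties using (*-homo-*)
  open import Relation.Nullary using (contradiction)
  open Parities

  2^N∣odd*m⇒2^N∣m : ∀ N {o m} → parity o ≡ 1ℙ → 2 ^ N ∣ o * m → 2 ^ N ∣ m
  2^N∣odd*m⇒2^N∣m zero    _     _ = 1∣ _
  2^N∣odd*m⇒2^N∣m (suc N) {o} {m} odd-o 2^[1+N]∣om with parity≡0⇒half m even-m
    where
    even-m : parity m ≡ 0ℙ
    even-m = begin
      parity m               ≡⟨ cong (ℙ._* parity m) odd-o ⟨
      parity o ℙ.* parity m  ≡⟨ *-homo-* o m ⟨
      parity (o * m)         ≡⟨ 2∣⇒parity≡0 (∣-trans (m∣m*n (2 ^ N)) 2^[1+N]∣om) ⟩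
      0ℙ                     ∎
      where open ≡-Reasoning
  ... | h , refl = *-monoʳ-∣ 2 (2^N∣odd*m⇒2^N∣m N {o} odd-o
                     (*-cancelˡ-∣ 2 (subst (2 * 2 ^ N ∣_) (o*[2*h]≡2*[o*h] o h) 2^[1+N]∣om)))
    where
    o*[2*h]≡2*[o*h] : ∀ o h → o * (2 * h) ≡ 2 * (o * h)
    o*[2*h]≡2*[o*h] = solve-∀

  m<n∧n∣m⇒m≡0 : ∀ {m n} → m < n → n ∣ m → m ≡ 0
  m<n∧n∣m⇒m≡0 {zero}  _   _   = refl
  m<n∧n∣m⇒m≡0 {suc m} m<n n∣m = contradiction (∣⇒≤ n∣m) (<⇒≱ m<n)

  odd*X≡2^N*Y⇒X≡0 : ∀ N {o} X Y → parity o ≡ 1ℙ → ∣ X ∣ < 2 ^ N → + o ℤ.* X ≡ + 2 ^ N ℤ.* Y → X ≡ 0ℤ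
  odd*X≡2^N*Y⇒X≡0 N {o} X Y odd-o ∣X∣<2^N eq =
    ∣i∣≡0⇒i≡0 (m<n∧n∣m⇒m≡0 ∣X∣<2^N (2^N∣odd*m⇒2^N∣m N {o} odd-o (divides ∣ Y ∣ (begin
      o * ∣ X ∣            ≡⟨ ∣i*j∣≡∣i∣*∣j∣ (+ o) X ⟨
      ∣ + o ℤ.* X ∣        ≡⟨ cong ∣_∣ eq ⟩
      ∣ + 2 ^ N ℤ.* Y ∣    ≡⟨ ∣i*j∣≡∣i∣*∣j∣ (+ 2 ^ N) Y ⟩
      2 ^ N * ∣ Y ∣        ≡⟨ *-comm (2 ^ N) ∣ Y ∣ ⟩
      ∣ Y ∣ * 2 ^ N        ∎))))
    where open ≡-Reasoning

  2-power-factorisation : ∀ n → 0 < n → Σ ℕ λ K → Σ ℕ λ w → n ≡ 2 ^ K * suc (2 * w)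
  2-power-factorisation = <-rec P step
    where
    P : ℕ → Set
    P n = 0 < n → Σ ℕ λ K → Σ ℕ λ w → n ≡ 2 ^ K * suc (2 * w)
    step : ∀ n → WfRec _<_ P n → P n
    step n rec 0<n with halve n
    ... | odd h        = 0 , h , sym (*-identityˡ _)
    ... | even (suc h) with rec (ℕ.m<m+n (suc h) (s≤s z≤n)) (s≤s z≤n)
    ...   | K , w , eq = suc K , w , trans (cong (2 *_) eq) (sym (*-assoc 2 (2 ^ K) (suc (2 * w))))

  m<n⇒m+n<2*n : ∀ {m} n → m < n → m + n < 2 * n
  m<n⇒m+n<2*n {m} n m<n = subst (m + n <_) (cong (ℕ._+_ n) (sym (ℕ.+-identityʳ n))) (ℕ.+-monoˡ-< n m<n)

  next-odd-multiple-representative : ∀ K (n : ℤ) w j p → j < 2 ^ K → n ≡ + j ℤ.* + suc (2 * w) ℤ.+ p ℤ.* + 2 ^ K →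
    Σ ℕ λ j′ → j′ < 2 ^ suc K × Σ ℤ λ p′ → n ≡ + j′ ℤ.* + suc (2 * w) ℤ.+ p′ ℤ.* + 2 ^ suc K
  next-odd-multiple-representative K n w j p j<2^K n≡ with p %ℕ 2 | n%ℕd<d p 2 | a≡a%ℕn+[a/ℕn]*n p 2
  ... | 0 | _ | p≡ = j , ℕ.≤-trans j<2^K (ℕ.m≤m+n (2 ^ K) _) , p /ℕ 2 , (begin
    n                                                  ≡⟨ n≡ ⟩
    + j ℤ.* O ℤ.+ p ℤ.* E                              ≡⟨ cong (λ p → + j ℤ.* O ℤ.+ p ℤ.* E) p≡ ⟩
    + j ℤ.* O ℤ.+ (+ 0 ℤ.+ p /ℕ 2 ℤ.* + 2) ℤ.* E       ≡⟨ regroup (+ j) O (p /ℕ 2) E ⟩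
    + j ℤ.* O ℤ.+ p /ℕ 2 ℤ.* (+ 2 ℤ.* E)               ≡⟨ cong (λ E → + j ℤ.* O ℤ.+ p /ℕ 2 ℤ.* E) (pos-* 2 (2 ^ K)) ⟨
    + j ℤ.* O ℤ.+ p /ℕ 2 ℤ.* + 2 ^ suc K               ∎)
    where
    open ≡-Reasoning
    O = + suc (2 * w)
    E = + 2 ^ K
    regroup : ∀ j O q E → j ℤ.* O ℤ.+ (+ 0 ℤ.+ q ℤ.* + 2) ℤ.* E ≡ j ℤ.* O ℤ.+ q ℤ.* (+ 2 ℤ.* E)
    regroup = ℤ-solve-∀
  ... | 1 | _ | p≡ = j + 2 ^ K , m<n⇒m+n<2*n (2 ^ K) j<2^K , p /ℕ 2 ℤ.- + w , (begin
    n                                                                     ≡⟨ n≡ ⟩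
    + j ℤ.* O ℤ.+ p ℤ.* E                                                 ≡⟨ cong (λ p → + j ℤ.* O ℤ.+ p ℤ.* E) p≡ ⟩
    + j ℤ.* O ℤ.+ (+ 1 ℤ.+ p /ℕ 2 ℤ.* + 2) ℤ.* E
      ≡⟨ cong (λ O → + j ℤ.* O ℤ.+ (+ 1 ℤ.+ p /ℕ 2 ℤ.* + 2) ℤ.* E) O≡1+2w ⟩
    + j ℤ.* (+ 1 ℤ.+ + 2 ℤ.* + w) ℤ.+ (+ 1 ℤ.+ p /ℕ 2 ℤ.* + 2) ℤ.* E      ≡⟨ regroup (+ j) (+ w) (p /ℕ 2) E ⟩
    (+ j ℤ.+ E) ℤ.* (+ 1 ℤ.+ + 2 ℤ.* + w) ℤ.+ (p /ℕ 2 ℤ.- + w) ℤ.* (+ 2 ℤ.* E)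
      ≡⟨ cong₂ (λ O E → (+ j ℤ.+ + 2 ^ K) ℤ.* O ℤ.+ (p /ℕ 2 ℤ.- + w) ℤ.* E) O≡1+2w (pos-* 2 (2 ^ K)) ⟨
    + (j + 2 ^ K) ℤ.* O ℤ.+ (p /ℕ 2 ℤ.- + w) ℤ.* + 2 ^ suc K               ∎)
    where
    open ≡-Reasoning
    O = + suc (2 * w)
    E = + 2 ^ K
    O≡1+2w : O ≡ + 1 ℤ.+ + 2 ℤ.* + w
    O≡1+2w = cong (λ x → + 1 ℤ.+ x) (pos-* 2 w)
    regroup : ∀ j w q E → j ℤ.* (+ 1 ℤ.+ + 2 ℤ.* w) ℤ.+ (+ 1 ℤ.+ q ℤ.* + 2) ℤ.* E
                        ≡ (j ℤ.+ E) ℤ.* (+ 1 ℤ.+ + 2 ℤ.* w) ℤ.+ (q ℤ.- w) ℤ.* (+ 2 ℤ.* E)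
    regroup = ℤ-solve-∀
  ... | suc (suc _) | s≤s (s≤s ()) | _

  odd-multiple-representative : ∀ K (n : ℤ) w →
                                Σ ℕ λ j → j < 2 ^ K × Σ ℤ λ p → n ≡ + j ℤ.* + suc (2 * w) ℤ.+ p ℤ.* + 2 ^ K
  odd-multiple-representative zero    n w = 0 , s≤s z≤n , n , base n (+ suc (2 * w))
    where
    base : ∀ n O → n ≡ + 0 ℤ.* O ℤ.+ n ℤ.* + 1
    base = ℤ-solve-∀
  odd-multiple-representative (suc K) n w with odd-multiple-representative K n w
  ... | j , j<2^K , p , n≡ = next-odd-multiple-representative K n w j p j<2^K n≡

  -- x ≃ j / 2ᴷ + p / o with 0 ≤ j < 2ᴷ and o odd. The denominators are kept in the form suc e and
  -- suc o, so that ↥ and ↧ of the ℚᵘ sum compute and cross-multiplication is definitional.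
  record DyadicSplitting (x : ℚᵘ) : Set where
    field
      K e j : ℕ
      1+e≡2^K : suc e ≡ 2 ^ K
      j<1+e : j < suc e
      p : ℤ
      o : ℕ
      odd-o : parity (suc o) ≡ 1ℙ
      splits : x ≃ + j / suc e ℚᵘ.+ p / suc o

  splitParity : ∀ {x} → DyadicSplitting x → Parity
  splitParity s = parityℤ (DyadicSplitting.p s)

  splitting : ∀ x → DyadicSplitting x
  splitting (mkℚᵘ n d) with 2-power-factorisation (suc d) (s≤s z≤n)
  ... | K , w , 1+d≡2^K*[1+2w] with odd-multiple-representative K n w
  ...   | j , j<2^K , p , n≡ = record
    { K = K ; e = pred (2 ^ K) ; j = j ; 1+e≡2^K = 1+e≡2^K ; j<1+e = subst (j <_) (sym 1+e≡2^K) j<2^K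
    ; p = p ; o = 2 * w ; odd-o = parity-odd w
    ; splits = *≡* (cong₂ ℤ._*_ n≡′ (cong +_ (sym 1+d≡[1+e]*[1+o])))
    }
    where
    1+e≡2^K : suc (pred (2 ^ K)) ≡ 2 ^ K
    1+e≡2^K = suc-pred (2 ^ K) {{m^n≢0 2 K}}
    o = 2 * w
    n≡′ : n ≡ + j ℤ.* + suc o ℤ.+ p ℤ.* + suc (pred (2 ^ K))
    n≡′ = trans n≡ (cong (λ E → + j ℤ.* + suc o ℤ.+ p ℤ.* + E) (sym 1+e≡2^K))
    1+d≡[1+e]*[1+o] : suc d ≡ suc (pred (2 ^ K)) * suc o
    1+d≡[1+e]*[1+o] = trans 1+d≡2^K*[1+2w] (cong (_* suc o) (sym 1+e≡2^K))

  shift : ∀ {x} → DyadicSplitting x → ∀ n o′ → parity (suc o′) ≡ 1ℙ → DyadicSplitting (x ℚᵘ.+ n / suc o′)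
  shift s n o′ odd-o′ = record
    { K = K ; e = e ; j = j ; 1+e≡2^K = 1+e≡2^K ; j<1+e = j<1+e
    ; p = p ℤ.* + suc o′ ℤ.+ n ℤ.* + suc o
    ; o = o′ + o * suc o′
    ; odd-o = parity-odd*odd (suc o) (suc o′) odd-o odd-o′
    ; splits = ℚᵘ.≃-trans (ℚᵘ.+-congˡ (n / suc o′) splits) (ℚᵘ.+-assoc (+ j / suc e) (p / suc o) (n / suc o′))
    }
    where open DyadicSplitting s

  splitParity-shift : ∀ {x} (s : DyadicSplitting x) n o′ (odd-o′ : parity (suc o′) ≡ 1ℙ) →
                      splitParity (shift s n o′ odd-o′) ≡ splitParity s ℙ.+ parityℤ n
  splitParity-shift s n o′ odd-o′ =
    trans (parityℤ-+ (p ℤ.* + suc o′) (n ℤ.* + suc o)) (cong₂ ℙ._+_ (parityℤ-*-odd p odd-o′) (parityℤ-*-odd n odd-o))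
    where open DyadicSplitting s

  cross-multiplied : ∀ j₁ j₂ p₁ p₂ E₁ E₂ O₁ O₂ →
                     (j₁ ℤ.* O₁ ℤ.+ p₁ ℤ.* E₁) ℤ.* (E₂ ℤ.* O₂) ≡ (j₂ ℤ.* O₂ ℤ.+ p₂ ℤ.* E₂) ℤ.* (E₁ ℤ.* O₁) →
                     O₁ ℤ.* O₂ ℤ.* (j₁ ℤ.* E₂ ℤ.- j₂ ℤ.* E₁) ≡ E₁ ℤ.* E₂ ℤ.* (p₂ ℤ.* O₁ ℤ.- p₁ ℤ.* O₂)
  cross-multiplied j₁ j₂ p₁ p₂ E₁ E₂ O₁ O₂ eq = begin
    O₁ ℤ.* O₂ ℤ.* (j₁ ℤ.* E₂ ℤ.- j₂ ℤ.* E₁)  ≡⟨ identity j₁ j₂ p₁ p₂ E₁ E₂ O₁ O₂ ⟩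
    C ℤ.+ (A ℤ.- B)                          ≡⟨ cong (λ a → C ℤ.+ (a ℤ.- B)) eq ⟩
    C ℤ.+ (B ℤ.- B)                          ≡⟨ a+[b-b]≡a C B ⟩
    C                                        ∎
    where
    open ≡-Reasoning
    C = E₁ ℤ.* E₂ ℤ.* (p₂ ℤ.* O₁ ℤ.- p₁ ℤ.* O₂)
    A = (j₁ ℤ.* O₁ ℤ.+ p₁ ℤ.* E₁) ℤ.* (E₂ ℤ.* O₂)
    B = (j₂ ℤ.* O₂ ℤ.+ p₂ ℤ.* E₂) ℤ.* (E₁ ℤ.* O₁)
    identity : ∀ j₁ j₂ p₁ p₂ E₁ E₂ O₁ O₂ →
      O₁ ℤ.* O₂ ℤ.* (j₁ ℤ.* E₂ ℤ.- j₂ ℤ.* E₁)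
        ≡ E₁ ℤ.* E₂ ℤ.* (p₂ ℤ.* O₁ ℤ.- p₁ ℤ.* O₂)
          ℤ.+ ((j₁ ℤ.* O₁ ℤ.+ p₁ ℤ.* E₁) ℤ.* (E₂ ℤ.* O₂) ℤ.- (j₂ ℤ.* O₂ ℤ.+ p₂ ℤ.* E₂) ℤ.* (E₁ ℤ.* O₁))
    identity = ℤ-solve-∀
    a+[b-b]≡a : ∀ a b → a ℤ.+ (b ℤ.- b) ≡ a
    a+[b-b]≡a = ℤ-solve-∀

  ∣j₁E₂-j₂E₁∣<E₁E₂ : ∀ {j₁ j₂ E₁ E₂} .{{_ : NonZero E₁}} .{{_ : NonZero E₂}} → j₁ < E₁ → j₂ < E₂ →
                     ∣ + j₁ ℤ.* + E₂ ℤ.- + j₂ ℤ.* + E₁ ∣ < E₁ * E₂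
  ∣j₁E₂-j₂E₁∣<E₁E₂ {j₁} {j₂} {E₁} {E₂} j₁<E₁ j₂<E₂ =
    subst (λ z → ∣ z ∣ < E₁ * E₂) (cong₂ ℤ._-_ (pos-* j₁ E₂) (pos-* j₂ E₁))
      (subst (λ z → ∣ z ∣ < E₁ * E₂) (sym ([+m]-[+n]≡m⊖n (j₁ * E₂) (j₂ * E₁)))
        (ℕ.≤-<-trans (∣m⊝n∣≤m⊔n (j₁ * E₂) (j₂ * E₁))
          (ℕ.⊔-lub (ℕ.*-monoˡ-< E₂ j₁<E₁) (subst (j₂ * E₁ <_) (*-comm E₂ E₁) (ℕ.*-monoˡ-< E₁ j₂<E₂)))))

  -- j₁/2^K₁ − j₂/2^K₂ = p₂/o₂ − p₁/o₁ is a dyadic number in (−1, 1) with odd denominator, hence 0.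
  splitParity-unique : ∀ {x y} → x ≃ y → (s : DyadicSplitting x) (t : DyadicSplitting y) →
                       splitParity s ≡ splitParity t
  splitParity-unique x≃y s t = begin
    parityℤ p₁                ≡⟨ parityℤ-*-odd p₁ odd-o₂ ⟨
    parityℤ (p₁ ℤ.* O₂)       ≡⟨ cong parityℤ (sym (i-j≡0⇒i≡j (p₂ ℤ.* O₁) (p₁ ℤ.* O₂) Y≡0)) ⟩
    parityℤ (p₂ ℤ.* O₁)       ≡⟨ parityℤ-*-odd p₂ odd-o₁ ⟩
    parityℤ p₂                ∎
    where
    open ≡-Reasoning
    open DyadicSplitting s renaming (K to K₁; e to e₁; j to j₁; 1+e≡2^K to 1+e₁≡2^K₁; j<1+e to j₁<1+e₁;
                                     p to p₁; o to o₁; odd-o to odd-o₁; splits to splits₁)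
    open DyadicSplitting t renaming (K to K₂; e to e₂; j to j₂; 1+e≡2^K to 1+e₂≡2^K₂; j<1+e to j₂<1+e₂;
                                     p to p₂; o to o₂; odd-o to odd-o₂; splits to splits₂)
    O₁ = + suc o₁
    O₂ = + suc o₂
    E₁E₂ = + (suc e₁ * suc e₂)
    X = + j₁ ℤ.* + suc e₂ ℤ.- + j₂ ℤ.* + suc e₁
    Y = p₂ ℤ.* O₁ ℤ.- p₁ ℤ.* O₂
    O₁O₂X≡E₁E₂Y : O₁ ℤ.* O₂ ℤ.* X ≡ E₁E₂ ℤ.* Y
    O₁O₂X≡E₁E₂Y = cross-multiplied (+ j₁) (+ j₂) p₁ p₂ (+ suc e₁) (+ suc e₂) O₁ O₂
                    (ℚᵘ.drop-*≡* (ℚᵘ.≃-trans (ℚᵘ.≃-sym splits₁) (ℚᵘ.≃-trans x≃y splits₂)))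
    E₁E₂≡2^[K₁+K₂] : suc e₁ * suc e₂ ≡ 2 ^ (K₁ + K₂)
    E₁E₂≡2^[K₁+K₂] = trans (cong₂ _*_ 1+e₁≡2^K₁ 1+e₂≡2^K₂) (sym (ℕ.^-distribˡ-+-* 2 K₁ K₂))
    X≡0 : X ≡ 0ℤ
    X≡0 = odd*X≡2^N*Y⇒X≡0 (K₁ + K₂) {suc o₁ * suc o₂} X Y (parity-odd*odd (suc o₁) (suc o₂) odd-o₁ odd-o₂)
            (subst (∣ X ∣ <_) E₁E₂≡2^[K₁+K₂] (∣j₁E₂-j₂E₁∣<E₁E₂ j₁<1+e₁ j₂<1+e₂))
            (trans O₁O₂X≡E₁E₂Y (cong (λ m → + m ℤ.* Y) E₁E₂≡2^[K₁+K₂]))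
    Y≡0 : Y ≡ 0ℤ
    Y≡0 = ℤ.*-cancelˡ-≡ E₁E₂ Y 0ℤ (begin
      E₁E₂ ℤ.* Y          ≡⟨ O₁O₂X≡E₁E₂Y ⟨
      O₁ ℤ.* O₂ ℤ.* X     ≡⟨ cong (O₁ ℤ.* O₂ ℤ.*_) X≡0 ⟩
      O₁ ℤ.* O₂ ℤ.* 0ℤ    ≡⟨ ℤ.*-zeroʳ (O₁ ℤ.* O₂) ⟩
      0ℤ                  ≡⟨ ℤ.*-zeroʳ E₁E₂ ⟨
      E₁E₂ ℤ.* 0ℤ         ∎)

  χ : ℚ → Parity
  χ a = splitParity (splitting (toℚᵘ a))

  χ-shift : ∀ a r → parity (↧ₙ r) ≡ 1ℙ → χ (a ℚ.+ r) ≡ χ a ℙ.+ parityℤ (↥ r)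
  χ-shift a r@(mkℚ n d _) odd-d = trans
    (splitParity-unique (toℚᵘ-homo-+ a r) (splitting (toℚᵘ (a ℚ.+ r))) (shift (splitting (toℚᵘ a)) n d odd-d))
    (splitParity-shift (splitting (toℚᵘ a)) n d odd-d)

  χ-difference : ∀ x y → parity (↧ₙ (x ℚ.- y)) ≡ 1ℙ → χ x ≡ χ y ℙ.+ parityℤ (↥ (x ℚ.- y))
  χ-difference x y odd-denominator = trans (cong χ (x≡y+[x-y] x y)) (χ-shift y (x ℚ.- y) odd-denominator)
    where
    x≡y+[x-y] : ∀ x y → x ≡ y ℚ.+ (x ℚ.- y)
    x≡y+[x-y] = RS.solve-∀ ℚ-ring

open import Data.Fin using (zero; suc)
open import Data.Integer using (+_)
open import Data.Rational using (0ℚ; 1ℚ; _+_; _*_; _-_; _/_; ↥_)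
open import Data.Vec using (_∷_; []; zipWith)
open import Data.Vec.Properties using (tabulate-cong; ∷-injective)
open import Data.Empty using (⊥)
import Data.Parity as ℙ
open Parities using (parityℤ)
open UnitCircle using (unitCircle)
open SumsOfTwoSquares using (3ℚ; x²+y²≡3[u²+v²]⇒u,v≡0ℚ)
open DyadicSplittings using (χ; χ-difference)

q : ℚ → ℚ → ℚ → ℚ
q a b c = + 1 / 3 * (a * a + b * b + + 2 / 1 * (c * c))

-- The left-hand sides of the expansions below are the definitional unfoldings of eval.
eval-qForm : ∀ a b c → eval qForm (a ∷ b ∷ c ∷ []) ≡ q a b c
eval-qForm = expansion
  where
  expansion : ∀ a b c →
      ((1ℚ * (+ 1 / 3)) * a * a + ((0ℚ * (+ 1 / 3)) * a * b + ((0ℚ * (+ 1 / 3)) * a * c + 0ℚ)))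
    + (((0ℚ * (+ 1 / 3)) * b * a + ((1ℚ * (+ 1 / 3)) * b * b + ((0ℚ * (+ 1 / 3)) * b * c + 0ℚ)))
    + (((0ℚ * (+ 2 / 3)) * c * a + ((0ℚ * (+ 2 / 3)) * c * b + ((1ℚ * (+ 2 / 3)) * c * c + 0ℚ))) + 0ℚ))
    ≡ + 1 / 3 * (a * a + b * b + + 2 / 1 * (c * c))
  expansion = RS.solve-∀ ℚ-ring

eval-I₂ : ∀ a b → eval I₂ (a ∷ b ∷ []) ≡ a * a + b * b
eval-I₂ = expansion
  where
  expansion : ∀ a b → (1ℚ * a * a + (0ℚ * a * b + 0ℚ)) + ((0ℚ * b * a + (1ℚ * b * b + 0ℚ)) + 0ℚ) ≡ a * a + b * b
  expansion = RS.solve-∀ ℚ-ring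

eval-I₂⊕r : ∀ (r : QForm 1) a b → eval (I₂ ⊕ r) (a ∷ b ∷ 0ℚ ∷ []) ≡ a * a + b * b
eval-I₂⊕r r = expansion (coeff r zero zero)
  where
  expansion : ∀ ρ a b →
      (1ℚ * a * a + (0ℚ * a * b + (0ℚ * a * 0ℚ + 0ℚ)))
    + ((0ℚ * b * a + (1ℚ * b * b + (0ℚ * b * 0ℚ + 0ℚ)))
    + ((0ℚ * 0ℚ * a + (0ℚ * 0ℚ * b + (ρ * 0ℚ * 0ℚ + 0ℚ))) + 0ℚ))
    ≡ a * a + b * b
  expansion = RS.solve-∀ ℚ-ring

fromParity : Parity → ℚ
fromParity 0ℙ = 0ℚ
fromParity 1ℙ = 1ℚ

φ : Vec ℚ 2 → Vec ℚ 3
φ (a ∷ b ∷ []) = a ∷ b ∷ fromParity (χ a) + fromParity (χ b) ∷ []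

φ-injective : ∀ x y → φ x ≡ φ y → x ≡ y
φ-injective (a ∷ b ∷ []) (c ∷ d ∷ []) eq with ∷-injective eq
... | refl , eq′ with ∷-injective eq′
...   | refl , _ = refl

height-gap : ∀ a b p p′ → p ℙ.+ p′ ≡ 1ℙ →
             let Δ = (fromParity (a ℙ.+ p) + fromParity (b ℙ.+ p′)) - (fromParity a + fromParity b) in Δ * Δ ≡ 1ℚ
height-gap 0ℙ 0ℙ 0ℙ 1ℙ _ = refl
height-gap 0ℙ 0ℙ 1ℙ 0ℙ _ = refl
height-gap 0ℙ 1ℙ 0ℙ 1ℙ _ = refl
height-gap 0ℙ 1ℙ 1ℙ 0ℙ _ = refl
height-gap 1ℙ 0ℙ 0ℙ 1ℙ _ = refl
height-gap 1ℙ 0ℙ 1ℙ 0ℙ _ = refl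
height-gap 1ℙ 1ℙ 0ℙ 1ℙ _ = refl
height-gap 1ℙ 1ℙ 1ℙ 0ℙ _ = refl
height-gap _  _  0ℙ 0ℙ ()
height-gap _  _  1ℙ 1ℙ ()

φ-adjacent : ∀ x y → Adj I₂ x y → Adj qForm (φ x) (φ y)
φ-adjacent (x₀ ∷ x₁ ∷ []) (y₀ ∷ y₁ ∷ []) adj = begin
  eval qForm (s ∷ t ∷ Δ ∷ [])                    ≡⟨ eval-qForm s t Δ ⟩
  + 1 / 3 * (s * s + t * t + + 2 / 1 * (Δ * Δ))  ≡⟨ cong (λ z → + 1 / 3 * (s * s + t * t + + 2 / 1 * z)) Δ²≡1 ⟩
  + 1 / 3 * (s * s + t * t + + 2 / 1 * 1ℚ)       ≡⟨ cong (λ z → + 1 / 3 * (z + + 2 / 1 * 1ℚ)) s²+t²≡1 ⟩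
  1ℚ                                             ∎
  where
  open ≡-Reasoning
  s = x₀ - y₀
  t = x₁ - y₁
  Δ = (fromParity (χ x₀) + fromParity (χ x₁)) - (fromParity (χ y₀) + fromParity (χ y₁))
  s²+t²≡1 : s * s + t * t ≡ 1ℚ
  s²+t²≡1 = trans (sym (eval-I₂ s t)) adj
  open Σ (unitCircle s t s²+t²≡1) renaming (proj₁ to odd-s; proj₂ to odd-t,opposite-parities)
  open Σ odd-t,opposite-parities renaming (proj₁ to odd-t; proj₂ to opposite-parities)
  Δ²≡1 : Δ * Δ ≡ 1ℚ
  Δ²≡1 = subst₂ (λ χ₀ χ₁ → gap χ₀ χ₁ * gap χ₀ χ₁ ≡ 1ℚ)
           (sym (χ-difference x₀ y₀ odd-s)) (sym (χ-difference x₁ y₁ odd-t))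
           (height-gap (χ y₀) (χ y₁) (parityℤ (↥ s)) (parityℤ (↥ t)) opposite-parities)
    where
    gap : Parity → Parity → ℚ
    gap χ₀ χ₁ = (fromParity χ₀ + fromParity χ₁) - (fromParity (χ y₀) + fromParity (χ y₁))

·-e₁+e₂ : ∀ (T : Mat 3) →
          T · (1ℚ ∷ 1ℚ ∷ 0ℚ ∷ []) ≡ zipWith _+_ (T · (1ℚ ∷ 0ℚ ∷ 0ℚ ∷ [])) (T · (0ℚ ∷ 1ℚ ∷ 0ℚ ∷ []))
·-e₁+e₂ T = tabulate-cong (λ i → row-additive (T i zero) (T i (suc zero)) (T i (suc (suc zero))))
  where
  row-additive : ∀ t₀ t₁ t₂ → t₀ * 1ℚ + (t₁ * 1ℚ + (t₂ * 0ℚ + 0ℚ))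
                              ≡ (t₀ * 1ℚ + (t₁ * 0ℚ + (t₂ * 0ℚ + 0ℚ))) + (t₀ * 0ℚ + (t₁ * 1ℚ + (t₂ * 0ℚ + 0ℚ)))
  row-additive = RS.solve-∀ ℚ-ring

cross-product-identity : ∀ u₀ u₁ u₂ v₀ v₁ v₂ →
  (u₂ * v₀ - v₂ * u₀) * (u₂ * v₀ - v₂ * u₀) + (u₂ * v₁ - v₂ * u₁) * (u₂ * v₁ - v₂ * u₁)
    ≡ 3ℚ * (v₂ * v₂ * q u₀ u₁ u₂ + u₂ * u₂ * q v₀ v₁ v₂
            - u₂ * v₂ * (q (u₀ + v₀) (u₁ + v₁) (u₂ + v₂) - q u₀ u₁ u₂ - q v₀ v₁ v₂))
cross-product-identity = identity
  where
  -- The let inlines q, which the ring solver would otherwise treat as an opaque function.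
  identity : ∀ u₀ u₁ u₂ v₀ v₁ v₂ → let q = λ a b c → + 1 / 3 * (a * a + b * b + + 2 / 1 * (c * c)) in
    (u₂ * v₀ - v₂ * u₀) * (u₂ * v₀ - v₂ * u₀) + (u₂ * v₁ - v₂ * u₁) * (u₂ * v₁ - v₂ * u₁)
      ≡ 3ℚ * (v₂ * v₂ * q u₀ u₁ u₂ + u₂ * u₂ * q v₀ v₁ v₂
              - u₂ * v₂ * (q (u₀ + v₀) (u₁ + v₁) (u₂ + v₂) - q u₀ u₁ u₂ - q v₀ v₁ v₂))
  identity = RS.solve-∀ ℚ-ring

no-q-orthonormal-pair : ∀ u v → eval qForm u ≡ 1ℚ → eval qForm v ≡ 1ℚ →
                        eval qForm (zipWith _+_ u v) ≡ 1ℚ + 1ℚ → ⊥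
no-q-orthonormal-pair (u₀ ∷ u₁ ∷ u₂ ∷ []) (v₀ ∷ v₁ ∷ v₂ ∷ []) qu qv quv =
  1≢0 (proj₁ (x²+y²≡3[u²+v²]⇒u,v≡0ℚ 1ℚ 0ℚ u₀ u₁ u₀²+u₁²≡3))
  where
  open ≡-Reasoning
  1≢0 : 1ℚ ≢ 0ℚ
  1≢0 ()
  cong₃ : ∀ (f : ℚ → ℚ → ℚ → ℚ) {a a′ b b′ c c′} → a ≡ a′ → b ≡ b′ → c ≡ c′ → f a b c ≡ f a′ b′ c′
  cong₃ f refl refl refl = refl
  q[u]≡1 : q u₀ u₁ u₂ ≡ 1ℚ
  q[u]≡1 = trans (sym (eval-qForm u₀ u₁ u₂)) qu
  q[v]≡1 : q v₀ v₁ v₂ ≡ 1ℚ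
  q[v]≡1 = trans (sym (eval-qForm v₀ v₁ v₂)) qv
  q[u+v]≡2 : q (u₀ + v₀) (u₁ + v₁) (u₂ + v₂) ≡ 1ℚ + 1ℚ
  q[u+v]≡2 = trans (sym (eval-qForm (u₀ + v₀) (u₁ + v₁) (u₂ + v₂))) quv
  u₂≡0 : u₂ ≡ 0ℚ
  u₂≡0 = proj₁ (x²+y²≡3[u²+v²]⇒u,v≡0ℚ u₂ v₂ (u₂ * v₀ - v₂ * u₀) (u₂ * v₁ - v₂ * u₁) (begin
    (u₂ * v₀ - v₂ * u₀) * (u₂ * v₀ - v₂ * u₀) + (u₂ * v₁ - v₂ * u₁) * (u₂ * v₁ - v₂ * u₁)
      ≡⟨ cross-product-identity u₀ u₁ u₂ v₀ v₁ v₂ ⟩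
    3ℚ * (v₂ * v₂ * q u₀ u₁ u₂ + u₂ * u₂ * q v₀ v₁ v₂
          - u₂ * v₂ * (q (u₀ + v₀) (u₁ + v₁) (u₂ + v₂) - q u₀ u₁ u₂ - q v₀ v₁ v₂))
      ≡⟨ cong₃ (λ a b c → 3ℚ * (v₂ * v₂ * a + u₂ * u₂ * b - u₂ * v₂ * (c - a - b))) q[u]≡1 q[v]≡1 q[u+v]≡2 ⟩
    3ℚ * (v₂ * v₂ * 1ℚ + u₂ * u₂ * 1ℚ - u₂ * v₂ * ((1ℚ + 1ℚ) - 1ℚ - 1ℚ))
      ≡⟨ simplify u₂ v₂ ⟩
    3ℚ * (u₂ * u₂ + v₂ * v₂)
      ∎))
    where
    simplify : ∀ u₂ v₂ → 3ℚ * (v₂ * v₂ * 1ℚ + u₂ * u₂ * 1ℚ - u₂ * v₂ * ((1ℚ + 1ℚ) - 1ℚ - 1ℚ))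
                       ≡ 3ℚ * (u₂ * u₂ + v₂ * v₂)
    simplify = RS.solve-∀ ℚ-ring
  u₀²+u₁²≡3 : u₀ * u₀ + u₁ * u₁ ≡ 3ℚ * (1ℚ * 1ℚ + 0ℚ * 0ℚ)
  u₀²+u₁²≡3 = begin
    u₀ * u₀ + u₁ * u₁                          ≡⟨ drop-last u₀ u₁ u₂ ⟩
    3ℚ * q u₀ u₁ u₂ - + 2 / 1 * (u₂ * u₂)      ≡⟨ cong₂ (λ a c → 3ℚ * a - + 2 / 1 * (c * c)) q[u]≡1 u₂≡0 ⟩
    3ℚ * 1ℚ - + 2 / 1 * (0ℚ * 0ℚ)              ≡⟨⟩
    3ℚ * (1ℚ * 1ℚ + 0ℚ * 0ℚ)                   ∎
    where
    drop-last : ∀ a b c → a * a + b * b ≡ 3ℚ * (+ 1 / 3 * (a * a + b * b + + 2 / 1 * (c * c))) - + 2 / 1 * (c * c)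
    drop-last = RS.solve-∀ ℚ-ring

I₂⋠qForm : ¬ (_⪯_ {2} {1} I₂ qForm)
I₂⋠qForm (r , _ , T , _ , H) = no-q-orthonormal-pair (T · e₁) (T · e₂)
  (trans (sym (H e₁)) (eval-I₂⊕r r 1ℚ 0ℚ))
  (trans (sym (H e₂)) (eval-I₂⊕r r 0ℚ 1ℚ))
  (trans (cong (eval qForm) (sym (·-e₁+e₂ T))) (trans (sym (H e₁+e₂)) (eval-I₂⊕r r 1ℚ 1ℚ)))
  where
  e₁ e₂ e₁+e₂ : Vec ℚ 3
  e₁ = 1ℚ ∷ 0ℚ ∷ 0ℚ ∷ []
  e₂ = 0ℚ ∷ 1ℚ ∷ 0ℚ ∷ []
  e₁+e₂ = 1ℚ ∷ 1ℚ ∷ 0ℚ ∷ []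

mainTheorem12 : Σ (Vec ℚ 2 → Vec ℚ 3) (λ φ →
                    ((x y : Vec ℚ 2) → φ x ≡ φ y → x ≡ y)
                  × ((x y : Vec ℚ 2) → Adj I₂ x y → Adj qForm (φ x) (φ y)))
                × ¬ (_⪯_ {2} {1} I₂ qForm)
mainTheorem12 = (φ , φ-injective , φ-adjacent) , I₂⋠qForm
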